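{- Let $\mu$ be an infinite cardinal. Every graph of cardinality $\mu$ which has no uncountable clique can be embedded in a random graph of cardinality $\mu$ which has no uncountable clique.
   Context: A graph is a set $V$ with a symmetric irreflexive relation $E$; a clique is a set of pairwise adjacent vertices. A random graph is a graph $(V,E)$ such that for any two disjoint finite sets of vertices $X,Y\subseteq V$ there is a vertex $v\notin X\cup Y$ adjacent to every element of $X$ and to no element of $Y$. -}

module Defs where

open import Level using (0ℓ)
open import Data.Nat using (ℕ)
open import Data.Product using (Σ; Σ-syntax; ∃; _×_)
open import Data.Sum using (_⊎_)
open import Data.List using (List)
open import Data.List.Membership.Propositional using (_∈_; _∉_)
open import Data.List.Relation.Unary.All using (All)
open import Relation.Nullary using (¬_)
open import Relation.Binary.PropositionalEquality using (_≡_; _≢_)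
open import Relation.Binary.Structures using (IsStrictTotalOrder)
open import Induction.WellFounded using (WellFounded)
open import Function.Definitions using (Injective)
open import Function.Bundles using (_↔_)

-- Classical logic (the paper works in ZFC); assumed as an explicit hypothesis.
ExcludedMiddle : Set₁
ExcludedMiddle = (P : Set) → P ⊎ ¬ P

record Graph : Set₁ where
  field
    V      : Set
    E      : V → V → Set
    sym    : ∀ {x y} → E x y → E y x
    irrefl : ∀ {x} → ¬ E x x
open Graph public

IsSubset : {A : Set} → (A → Set) → Set
IsSubset {A} C = ∀ (x : A) (p q : C x) → p ≡ q

-- A set is countable (finite or countably infinite) iff it injects into ℕ.
Countable : Set → Set
Countable A = Σ (A → ℕ) λ f → Injective _≡_ _≡_ f

IsClique : (G : Graph) → (V G → Set) → Set
IsClique G C = ∀ x y → C x → C y → x ≢ y → E G x y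

NoUncountableClique : Graph → Set₁
NoUncountableClique G =
  ¬ (Σ[ C ∈ (V G → Set) ] (IsSubset C × IsClique G C × ¬ Countable (Σ (V G) C)))

-- Random graph: for any two disjoint finite sets of vertices X, Y there is a
-- vertex v ∉ X ∪ Y adjacent to every element of X and to no element of Y.
-- Finite sets are represented by lists.
IsRandomGraph : Graph → Set
IsRandomGraph G =
  (X Y : List (V G)) → (∀ x → x ∈ X → x ∈ Y → ⊥') →
  Σ[ v ∈ V G ] (v ∉ X × v ∉ Y × All (E G v) X × All (λ y → ¬ E G v y) Y)
  where open import Data.Empty renaming (⊥ to ⊥')

record Embedding (G H : Graph) : Set where
  field
    map        : V G → V H
    injective  : Injective _≡_ _≡_ map
    preserves  : ∀ {x y} → E G x y → E H (map x) (map y)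
    reflects   : ∀ {x y} → E H (map x) (map y) → E G x y

-- A set is infinite (Dedekind) : ℕ injects into it.
Infinite : Set → Set
Infinite A = Σ (ℕ → A) λ f → Injective _≡_ _≡_ f

WellOrderable : Set → Set₁
WellOrderable A = Σ[ _<_ ∈ (A → A → Set) ] (IsStrictTotalOrder _≡_ _<_ × WellFounded _<_)

SameCardinality : Set → Set → Set
SameCardinality A B = A ↔ B

-- Extend G by terms: besides the old vertices, every pair of finite lists X, Y of terms gives
-- a new vertex new X Y, adjacent exactly to the members of X (and to the new vertices listing
-- it). An edge at a new vertex
-- always changes the nesting rank, so a clique has at most one new vertex of each rank, and
-- the rest of it is a clique of G, hence countable.
--
-- For the cardinality, terms are coded into ℕ ⊎ V G by a pairing (ℕ ⊎ A)² ↣ ℕ ⊎ A, which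
-- Hessenberg's argument provides for every well-ordered A, by induction on initial segments:
-- a segment no larger than a smaller one inherits the pairing of the smaller one; otherwise
-- the Gödel ordering of its square embeds into it by comparability of well-orders, because
-- every proper initial part of that ordering lies in the square of a smaller segment.
-- Hilbert's hotel and Cantor–Schröder–Bernstein turn the coding and old into a bijection.
module Submission where

open import Defs hiding (sym)
open import Level using (0ℓ)
open import Data.Nat as ℕ using (ℕ; zero; suc; _*_; _⊔_; s≤s)
import Data.Nat.Properties as ℕ
import Data.Nat.Induction as ℕ
open import Data.Nat.GeneralisedArithmetic using (fold)
open import Data.Product using (Σ; Σ-syntax; ∃; ∃-syntax; _×_; _,_; proj₁; proj₂)
open import Data.Product.Function.NonDependent.Propositional using (_×-↣_)
open import Data.Product.Relation.Binary.Lex.Strict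
  using (×-Lex; ×-compare; ×-transitive; ×-wellFounded)
open import Data.Product.Relation.Binary.Pointwise.NonDependent using (≡×≡⇒≡; ≡⇒≡×≡)
open import Data.Sum using (_⊎_; inj₁; inj₂; swap; map₂) renaming (map to ⊎-map)
open import Data.Sum.Algebra using (⊎-assoc)
open import Data.Sum.Function.Propositional using (_⊎-↣_)
open import Data.Sum.Properties using (inj₁-injective; inj₂-injective)
open import Data.Sum.Relation.Binary.LeftOrder
  using (_⊎-<_; ₁∼₂; ₂∼₂; ⊎-<-trichotomous; ⊎-<-transitive; ⊎-<-wellFounded)
open import Data.Sum.Relation.Binary.Pointwise using (Pointwise-≡⇒≡; ≡⇒Pointwise-≡)
open import Data.Empty using (⊥; ⊥-elim)
import Data.Empty.Irrelevant as Irrelevant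
open import Data.Irrelevant using ([_])
open import Data.Refinement using (Refinement; _,_; value; value-injective)
open import Data.List using (List; []; _∷_)
open import Data.List.Membership.Propositional using (_∈_)
open import Data.List.Relation.Unary.Any using (here; there)
import Data.List.Relation.Unary.All as All
open import Function.Base using (_∘_; _∘′_; _on_)
open import Function.Bundles using (_↣_; _↔_; mk↣; mk↔ₛ′; Injection)
open import Function.Construct.Composition using (_↣-∘_)
open import Function.Construct.Identity using (↣-id)
open import Function.Definitions using (Injective; StrictlyInverseʳ)
open import Function.Properties.Inverse using (↔⇒↣; ↔-sym)
open import Induction.WellFounded as WF using (WellFounded; WfRec; Acc; acc)
open import Relation.Nullary using (¬_)
open import Relation.Nullary.Decidable using (recompute)
open import Relation.Nullary.Construct.Add.Supremum using (⊤⁺; [_])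
open import Relation.Binary.Core using (Rel)
open import Relation.Binary.Definitions using (Trichotomous; Transitive; tri<; tri≈; tri>)
open import Relation.Binary.Consequences using (tri⇒asym; tri⇒irr; tri⇒dec<)
open import Relation.Binary.Structures using (IsStrictTotalOrder)
import Relation.Binary.Construct.On as On
import Relation.Binary.Construct.StrictToNonStrict as StrictToNonStrict
import Relation.Binary.Construct.Add.Supremum.Strict as Supremum
open import Relation.Binary.PropositionalEquality using (_≡_; _≢_; refl; sym; cong; cong₂; subst)
import Relation.Binary.PropositionalEquality as ≡

module _ (em : ExcludedMiddle) where

  ¬¬-elim : {P : Set} → ¬ ¬ P → P
  ¬¬-elim {P} ¬¬p with em P
  ... | inj₁ p = p
  ... | inj₂ ¬p = ⊥-elim (¬¬p ¬p)

retraction⇒↣ : {A B : Set} {to : A → B} (from : B → A) → StrictlyInverseʳ _≡_ to from → A ↣ B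
retraction⇒↣ from inverse =
  mk↣ λ {x} {y} eq → ≡.trans (sym (inverse x)) (≡.trans (cong from eq) (inverse y))

ℕ⊎ℕ↣ℕ : (ℕ ⊎ ℕ) ↣ ℕ
ℕ⊎ℕ↣ℕ = mk↣ injective
  where
  code : ℕ ⊎ ℕ → ℕ
  code (inj₁ m) = 2 * m
  code (inj₂ n) = suc (2 * n)
  injective : ∀ {x y} → code x ≡ code y → x ≡ y
  injective {inj₁ m} {inj₁ n} eq = cong inj₁ (ℕ.*-cancelˡ-≡ m n 2 eq)
  injective {inj₁ m} {inj₂ n} eq = ⊥-elim (ℕ.even≢odd m n eq)
  injective {inj₂ m} {inj₁ n} eq = ⊥-elim (ℕ.even≢odd n m (sym eq))
  injective {inj₂ m} {inj₂ n} eq = cong inj₂ (ℕ.*-cancelˡ-≡ m n 2 (ℕ.suc-injective eq))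

ℕ×ℕ↣ℕ : (ℕ × ℕ) ↣ ℕ
ℕ×ℕ↣ℕ = mk↣ injective
  where
  open Injection ℕ⊎ℕ↣ℕ using () renaming (to to code; injective to code-injective)
  pair : ℕ × ℕ → ℕ
  pair (zero , n) = code (inj₂ n)
  pair (suc m , n) = code (inj₁ (pair (m , n)))
  injective : ∀ {x y} → pair x ≡ pair y → x ≡ y
  injective {zero , _} {zero , _} eq = cong (zero ,_) (inj₂-injective (code-injective eq))
  injective {zero , n} {suc m′ , n′} eq with () ← code-injective {inj₂ n} {inj₁ (pair (m′ , n′))} eq
  injective {suc m , n} {zero , n′} eq with () ← code-injective {inj₁ (pair (m , n))} {inj₂ n′} eq
  injective {suc m , n} {suc m′ , n′} eq
    with refl ← injective {m , n} {m′ , n′} (inj₁-injective (code-injective eq)) = refl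

module _ (em : ExcludedMiddle) {A : Set} (ℕ↣A : ℕ ↣ A) where

  private
    open Injection ℕ↣A using () renaming (to to ι)
    open Injection (ℕ↣A ↣-∘ ℕ⊎ℕ↣ℕ) using () renaming (to to room; injective to room-injective)

    Occupied : A → Set
    Occupied a = ∃[ k ] ι k ≡ a

    move : (a : A) → Occupied a ⊎ ¬ Occupied a → A
    move a (inj₁ (k , _)) = room (inj₂ k)
    move a (inj₂ _) = a

    room≢move : ∀ n a d → room (inj₁ n) ≢ move a d
    room≢move n a (inj₁ (k , _)) eq with () ← room-injective {inj₁ n} {inj₂ k} eq
    room≢move n a (inj₂ free) eq = free (_ , eq)

    move-injective : ∀ a a′ d d′ → move a d ≡ move a′ d′ → a ≡ a′
    move-injective a a′ (inj₁ (k , refl)) (inj₁ (k′ , refl)) eq =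
      cong ι (inj₂-injective (room-injective eq))
    move-injective a a′ (inj₁ (k , refl)) (inj₂ free′) eq = ⊥-elim (free′ (_ , eq))
    move-injective a a′ (inj₂ free) (inj₁ (k′ , refl)) eq = ⊥-elim (free (_ , sym eq))
    move-injective a a′ (inj₂ _) (inj₂ _) eq = eq

    hotel : ℕ ⊎ A → A
    hotel (inj₁ n) = room (inj₁ n)
    hotel (inj₂ a) = move a (em (Occupied a))

    hotel-injective : ∀ {x y} → hotel x ≡ hotel y → x ≡ y
    hotel-injective {inj₁ m} {inj₁ n} eq = cong inj₁ (inj₁-injective (room-injective eq))
    hotel-injective {inj₁ m} {inj₂ a} eq = ⊥-elim (room≢move m a (em (Occupied a)) eq)
    hotel-injective {inj₂ a} {inj₁ n} eq = ⊥-elim (room≢move n a (em (Occupied a)) (sym eq))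
    hotel-injective {inj₂ a} {inj₂ a′} eq =
      cong inj₂ (move-injective a a′ (em (Occupied a)) (em (Occupied a′)) eq)

  hilbert-hotel : (ℕ ⊎ A) ↣ A
  hilbert-hotel = mk↣ hotel-injective

module _ (em : ExcludedMiddle) {A B : Set} (A↣B : A ↣ B) (B↣A : B ↣ A) where

  private
    open Injection A↣B using () renaming (to to f; injective to f-injective)
    open Injection B↣A using () renaming (to to g; injective to g-injective)

    Orphan : A → Set
    Orphan a = ¬ (∃[ b ] g b ≡ a)

    Descendant : A → Set
    Descendant a = ∃[ n ] ∃[ a₀ ] Orphan a₀ × fold a₀ (g ∘ f) n ≡ a

    parent : ∀ {a} → ¬ Descendant a → ∃[ b ] g b ≡ a
    parent {a} ¬d = ¬¬-elim em λ orphan → ¬d (0 , a , orphan , refl)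

    to : A → B
    to a with em (Descendant a)
    ... | inj₁ _ = f a
    ... | inj₂ ¬d = proj₁ (parent ¬d)

    from : B → A
    from b with em (Descendant (g b))
    ... | inj₁ (zero , a₀ , orphan , a₀≡gb) = ⊥-elim (orphan (b , sym a₀≡gb))
    ... | inj₁ (suc n , a₀ , _ , _) = fold a₀ (g ∘ f) n
    ... | inj₂ _ = g b

    from-to : ∀ a → from (to a) ≡ a
    from-to a with em (Descendant a)
    from-to a | inj₁ (n , a₀ , orphan , eq) with em (Descendant (g (f a)))
    ... | inj₁ (zero , a₀′ , orphan′ , eq′) = ⊥-elim (orphan′ (f a , sym eq′))
    ... | inj₁ (suc k , a₀′ , _ , eq′) = f-injective (g-injective eq′)
    ... | inj₂ ¬d = ⊥-elim (¬d (suc n , a₀ , orphan , cong (g ∘ f) eq))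
    from-to a | inj₂ ¬d with em (Descendant (g (proj₁ (parent ¬d))))
    ... | inj₁ d = ⊥-elim (¬d (subst Descendant (proj₂ (parent ¬d)) d))
    ... | inj₂ _ = proj₂ (parent ¬d)

    to-from : ∀ b → to (from b) ≡ b
    to-from b with em (Descendant (g b))
    to-from b | inj₁ (zero , a₀ , orphan , eq) = ⊥-elim (orphan (b , sym eq))
    to-from b | inj₁ (suc n , a₀ , orphan , eq) with em (Descendant (fold a₀ (g ∘ f) n))
    ... | inj₁ _ = g-injective eq
    ... | inj₂ ¬d = ⊥-elim (¬d (n , a₀ , orphan , refl))
    to-from b | inj₂ ¬d with em (Descendant (g b))
    ... | inj₁ d = ⊥-elim (¬d d)
    ... | inj₂ ¬d′ = g-injective (proj₂ (parent ¬d′))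

  cantor-schröder-bernstein : A ↔ B
  cantor-schröder-bernstein = mk↔ₛ′ to from to-from from-to

record IsWellOrder {A : Set} (_<_ : Rel A 0ℓ) : Set where
  field
    compare     : Trichotomous _≡_ _<_
    trans       : Transitive _<_
    wellFounded : WellFounded _<_

Segment : {A : Set} → Rel A 0ℓ → A → Set
Segment {A} _<_ a = Refinement A (_< a)

module _ {A : Set} {_≈_ _<_ : Rel A 0ℓ}
         (≈⇒≡ : ∀ {x y} → x ≈ y → x ≡ y) (≡⇒≈ : ∀ {x y} → x ≡ y → x ≈ y) where

  trichotomous-≡ : Trichotomous _≈_ _<_ → Trichotomous _≡_ _<_
  trichotomous-≡ compare x y with compare x y
  ... | tri< x<y x≉y x≯y = tri< x<y (x≉y ∘′ ≡⇒≈) x≯y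
  ... | tri≈ x≮y x≈y x≯y = tri≈ x≮y (≈⇒≡ x≈y) x≯y
  ... | tri> x≮y x≉y x>y = tri> x≮y (x≉y ∘′ ≡⇒≈) x>y

<-isWellOrder : IsWellOrder ℕ._<_
<-isWellOrder = record { compare = ℕ.<-cmp ; trans = ℕ.<-trans ; wellFounded = ℕ.<-wellFounded }

module _ {A B : Set} {_<₁_ : Rel A 0ℓ} {_<₂_ : Rel B 0ℓ}
         (wo₁ : IsWellOrder _<₁_) (wo₂ : IsWellOrder _<₂_) where

  private
    module W₁ = IsWellOrder wo₁
    module W₂ = IsWellOrder wo₂

  ⊎-<-isWellOrder : IsWellOrder (_<₁_ ⊎-< _<₂_)
  ⊎-<-isWellOrder = record
    { compare     = trichotomous-≡ Pointwise-≡⇒≡ ≡⇒Pointwise-≡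
                      (⊎-<-trichotomous W₁.compare W₂.compare)
    ; trans       = ⊎-<-transitive W₁.trans W₂.trans
    ; wellFounded = ⊎-<-wellFounded W₁.wellFounded W₂.wellFounded
    }

  ×-Lex-isWellOrder : IsWellOrder (×-Lex _≡_ _<₁_ _<₂_)
  ×-Lex-isWellOrder = record
    { compare     = trichotomous-≡ ≡×≡⇒≡ ≡⇒≡×≡ (×-compare sym W₁.compare W₂.compare)
    ; trans       = ×-transitive {_<₂_ = _<₂_} ≡.isEquivalence (≡.resp₂ _<₁_) W₁.trans W₂.trans
    ; wellFounded = ×-wellFounded W₁.wellFounded W₂.wellFounded
    }

on-isWellOrder : {A B : Set} {_<_ : Rel A 0ℓ} (f : B → A) → Injective _≡_ _≡_ f →
                 IsWellOrder _<_ → IsWellOrder (_<_ on f)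
on-isWellOrder {_<_ = _<_} f f-injective wo = record
  { compare     = trichotomous-≡ f-injective (cong f) (On.trichotomous f _≡_ _<_ compare)
  ; trans       = On.transitive f _<_ trans
  ; wellFounded = On.wellFounded f wellFounded
  }
  where open IsWellOrder wo

module _ {A : Set} {_<_ : Rel A 0ℓ} where

  open Supremum _<_ using (_<⁺_; [_]; [_]<⊤⁺; <⁺-cmp-≡; <⁺-trans)

  <⁺-isWellOrder : IsWellOrder _<_ → IsWellOrder _<⁺_
  <⁺-isWellOrder wo = record
    { compare     = <⁺-cmp-≡ compare
    ; trans       = <⁺-trans trans
    ; wellFounded = <⁺-wellFounded
    }
    where
    open IsWellOrder wo
    acc[_] : ∀ {x} → Acc _<_ x → Acc _<⁺_ [ x ]
    acc[ acc rs ] = acc λ { [ y<x ] → acc[ rs y<x ] }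
    <⁺-wellFounded : WellFounded _<⁺_
    <⁺-wellFounded [ x ] = acc[ wellFounded x ]
    <⁺-wellFounded ⊤⁺ = acc λ { [ y ]<⊤⁺ → acc[ wellFounded y ] }

-- F p is the least element of Y not taken by F below p. If Y is used up below p, choosing
-- preimages embeds Y below p; otherwise F is injective.
module Comparability (em : ExcludedMiddle) {X Y : Set} {_≺_ : Rel X 0ℓ} {_<_ : Rel Y 0ℓ}
                     (≺-wo : IsWellOrder _≺_) (<-wo : IsWellOrder _<_) where

  private
    open IsWellOrder ≺-wo using () renaming (compare to ≺-compare; wellFounded to ≺-wellFounded)
    open IsWellOrder <-wo using () renaming (compare to <-compare; wellFounded to <-wellFounded)

    Least : (Y → Set) → Y → Set
    Least P y = P y × (∀ {z} → z < y → ¬ P z)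

    least : ∀ {P} → ∃ P → ∃ (Least P)
    least {P} (y , py) = go y (<-wellFounded y) py
      where
      go : ∀ y → Acc _<_ y → P y → ∃ (Least P)
      go y (acc smaller) py with em (∃[ z ] z < y × P z)
      ... | inj₁ (z , z<y , pz) = go z (smaller z<y) pz
      ... | inj₂ none = y , py , λ z<y pz → none (_ , z<y , pz)

    least-unique : ∀ {P Q y z} → (∀ {x} → P x → Q x) → (∀ {x} → Q x → P x) →
                   Least P y → Least Q z → y ≡ z
    least-unique {y = y} {z} P⇒Q Q⇒P (py , P-min) (qz , Q-min) with <-compare y z
    ... | tri< y<z _ _ = ⊥-elim (Q-min y<z (P⇒Q py))
    ... | tri≈ _ y≡z _ = y≡z
    ... | tri> _ _ z<y = ⊥-elim (P-min z<y (Q⇒P qz))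

  module _ (¬below : ¬ (∃[ p ] (Y ↣ Segment _≺_ p))) where

    private
      -- Only keeps next total: next-fresh shows that it is never reached along F.
      inhabitant : X → Y
      inhabitant p with em Y
      ... | inj₁ y = y
      ... | inj₂ ¬y = ⊥-elim (¬below (p , mk↣ {to = λ y → ⊥-elim (¬y y)} λ {y} _ → ⊥-elim (¬y y)))

      Fresh : ∀ {p} → WfRec _≺_ (λ _ → Y) p → Y → Set
      Fresh {p} IH y = ∀ {q} (q≺p : q ≺ p) → IH q≺p ≢ y

      next : ∀ p → WfRec _≺_ (λ _ → Y) p → Y
      next p IH with em (∃ (Fresh IH))
      ... | inj₁ fresh = proj₁ (least fresh)
      ... | inj₂ _ = inhabitant p

      module _ {p} {IH IH′ : WfRec _≺_ (λ _ → Y) p}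
               (IH≗IH′ : ∀ {q} (q≺p : q ≺ p) → IH q≺p ≡ IH′ q≺p) where

        fresh⇒fresh′ : ∀ {y} → Fresh IH y → Fresh IH′ y
        fresh⇒fresh′ fresh q≺p = fresh q≺p ∘′ ≡.trans (IH≗IH′ q≺p)

        fresh′⇒fresh : ∀ {y} → Fresh IH′ y → Fresh IH y
        fresh′⇒fresh fresh′ q≺p = fresh′ q≺p ∘′ ≡.trans (sym (IH≗IH′ q≺p))

        -- Taking the least fresh element, not just any, is what makes next extensional.
        next-ext : next p IH ≡ next p IH′
        next-ext with em (∃ (Fresh IH)) | em (∃ (Fresh IH′))
        ... | inj₁ fresh | inj₁ fresh′ =
          least-unique fresh⇒fresh′ fresh′⇒fresh (proj₂ (least fresh)) (proj₂ (least fresh′))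
        ... | inj₁ (y , fresh) | inj₂ ¬fresh′ = ⊥-elim (¬fresh′ (y , fresh⇒fresh′ fresh))
        ... | inj₂ ¬fresh | inj₁ (y , fresh′) = ⊥-elim (¬fresh (y , fresh′⇒fresh fresh′))
        ... | inj₂ _ | inj₂ _ = refl

      F : X → Y
      F = WF.All.wfRec ≺-wellFounded 0ℓ (λ _ → Y) next

      F-unfold : ∀ {p} → F p ≡ next p (λ {q} _ → F q)
      F-unfold = WF.FixPoint.unfold-wfRec ≺-wellFounded (λ _ → Y) next (λ p → next-ext {p})

      exhausted : ∀ p → ¬ ∃ (Fresh {p} λ {q} _ → F q) → Y ↣ Segment _≺_ p
      exhausted p ¬fresh = retraction⇒↣ {to = λ y → proj₁ (source y) , [ proj₁ (proj₂ (source y)) ]}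
                                        (F ∘′ value) (λ y → proj₂ (proj₂ (source y)))
        where
        source : ∀ y → ∃[ q ] q ≺ p × F q ≡ y
        source y = ¬¬-elim em λ none → ¬fresh (y , λ q≺p Fq≡y → none (_ , q≺p , Fq≡y))

      next-fresh : ∀ p → Fresh (λ {q} _ → F q) (next p (λ {q} _ → F q))
      next-fresh p with em (∃ (Fresh {p} λ {q} _ → F q))
      ... | inj₁ fresh = proj₁ (proj₂ (least fresh))
      ... | inj₂ ¬fresh = ⊥-elim (¬below (p , exhausted p ¬fresh))

      F-fresh : ∀ p → Fresh (λ {q} _ → F q) (F p)
      F-fresh p = subst (Fresh _) (sym F-unfold) (next-fresh p)

      F-injective : Injective _≡_ _≡_ F
      F-injective {p} {q} Fp≡Fq with ≺-compare p q
      ... | tri< p≺q _ _ = ⊥-elim (F-fresh q p≺q Fp≡Fq)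
      ... | tri≈ _ p≡q _ = p≡q
      ... | tri> _ _ q≺p = ⊥-elim (F-fresh p q≺p (sym Fp≡Fq))

    ¬below⇒↣ : X ↣ Y
    ¬below⇒↣ = mk↣ F-injective

  comparable : (X ↣ Y) ⊎ ∃[ p ] (Y ↣ Segment _≺_ p)
  comparable with em (∃[ p ] (Y ↣ Segment _≺_ p))
  ... | inj₁ below = inj₂ below
  ... | inj₂ ¬below = inj₁ (¬below⇒↣ ¬below)

-- Gödel's ordering of pairs; what matters is that the pairs below p lie in the square of the
-- non-strict segment below max p.
module Square {Y : Set} {_<_ : Rel Y 0ℓ} (wo : IsWellOrder _<_) where

  open IsWellOrder wo
  open StrictToNonStrict _≡_ _<_ public using (_≤_)

  ≤-trans : Transitive _≤_
  ≤-trans = StrictToNonStrict.trans _≡_ _<_ ≡.isEquivalence (≡.resp₂ _<_) trans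

  ≤⇒≯ : ∀ {x y} → x ≤ y → ¬ (y < x)
  ≤⇒≯ (inj₁ x<y) y<x = tri⇒asym compare x<y y<x
  ≤⇒≯ (inj₂ refl) x<x = tri⇒irr compare refl x<x

  max : Y × Y → Y
  max (x , y) with compare x y
  ... | tri< _ _ _ = y
  ... | tri≈ _ _ _ = x
  ... | tri> _ _ _ = x

  ≤max₁ : ∀ p → proj₁ p ≤ max p
  ≤max₁ (x , y) with compare x y
  ... | tri< x<y _ _ = inj₁ x<y
  ... | tri≈ _ _ _ = inj₂ refl
  ... | tri> _ _ _ = inj₂ refl

  ≤max₂ : ∀ p → proj₂ p ≤ max p
  ≤max₂ (x , y) with compare x y
  ... | tri< _ _ _ = inj₂ refl
  ... | tri≈ _ x≡y _ = inj₂ (sym x≡y)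
  ... | tri> _ _ y<x = inj₁ y<x

  key : Y × Y → Y × (Y × Y)
  key p = max p , p

  _≺_ : Rel (Y × Y) 0ℓ
  _≺_ = ×-Lex _≡_ _<_ (×-Lex _≡_ _<_ _<_) on key

  ≺-isWellOrder : IsWellOrder _≺_
  ≺-isWellOrder = on-isWellOrder key (cong proj₂) (×-Lex-isWellOrder wo (×-Lex-isWellOrder wo wo))

  ≺⇒max≤ : ∀ {p q} → p ≺ q → max p ≤ max q
  ≺⇒max≤ = map₂ proj₁

  segment↣square : ∀ p → Segment _≺_ p ↣ (Segment _≤_ (max p) × Segment _≤_ (max p))
  segment↣square p = mk↣ {to = to} injective
    where
    to : Segment _≺_ p → Segment _≤_ (max p) × Segment _≤_ (max p)
    to (q , [ q≺p ]) = (proj₁ q , [ ≤-trans (≤max₁ q) (≺⇒max≤ q≺p) ])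
                     , (proj₂ q , [ ≤-trans (≤max₂ q) (≺⇒max≤ q≺p) ])
    injective : Injective _≡_ _≡_ to
    injective eq = value-injective (cong₂ _,_ (cong (value ∘′ proj₁) eq) (cong (value ∘′ proj₂) eq))

Pairing : Set → Set
Pairing P = (P × P) ↣ P

ℕ-absorbs : {S : Set} → (ℕ ⊎ (ℕ ⊎ S)) ↣ (ℕ ⊎ S)
ℕ-absorbs {S} = (ℕ⊎ℕ↣ℕ ⊎-↣ ↣-id _) ↣-∘ ↔⇒↣ (↔-sym (⊎-assoc 0ℓ ℕ ℕ S))

pairing-countable : {S : Set} → S ↣ ℕ → Pairing (ℕ ⊎ S)
pairing-countable S↣ℕ = mk↣ inj₁-injective ↣-∘ (ℕ×ℕ↣ℕ ↣-∘ (toℕ ×-↣ toℕ))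
  where toℕ = ℕ⊎ℕ↣ℕ ↣-∘ (↣-id _ ⊎-↣ S↣ℕ)

pairing-transfer : {S S′ : Set} → S ↣ (ℕ ⊎ S′) → S′ ↣ S → Pairing (ℕ ⊎ S′) → Pairing (ℕ ⊎ S)
pairing-transfer S↣S′ S′↣S pair = (↣-id _ ⊎-↣ S′↣S) ↣-∘ (pair ↣-∘ (shrink ×-↣ shrink))
  where shrink = ℕ-absorbs ↣-∘ (↣-id _ ⊎-↣ S↣S′)

-- Pairings are sought on ℕ ⊎ S rather than on S, which has none when it is finite with at
-- least two elements.
module Hessenberg (em : ExcludedMiddle) {W : Set} {_<_ : Rel W 0ℓ} (wo : IsWellOrder _<_) where

  open IsWellOrder wo

  Seg : W → Set
  Seg = Segment _<_

  _<ʸ_ : ∀ {β} → Rel (ℕ ⊎ Seg β) 0ℓ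
  _<ʸ_ = ℕ._<_ ⊎-< (_<_ on value)

  <ʸ-isWellOrder : ∀ β → IsWellOrder (_<ʸ_ {β})
  <ʸ-isWellOrder β = ⊎-<-isWellOrder <-isWellOrder (on-isWellOrder value value-injective wo)

  module Pairs {β} = Square (<ʸ-isWellOrder β)
  open Pairs using (_≤_; _≺_; max; ≤⇒≯)

  Small : W → Set
  Small β = (Seg β ↣ ℕ) ⊎ ∃[ γ ] γ < β × (Seg β ↣ (ℕ ⊎ Seg γ))

  SmallerPairings : W → Set
  SmallerPairings β = ∀ {γ} → γ < β → Pairing (ℕ ⊎ Seg γ)

  <⇒Seg↣Seg : ∀ {γ β} → γ < β → Seg γ ↣ Seg β
  <⇒Seg↣Seg {γ} {β} γ<β = mk↣ {to = to} (value-injective ∘′ cong value)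
    where
    to : Seg γ → Seg β
    to (x , [ x<γ ]) = x , [ trans x<γ γ<β ]

  small⇒pairing : ∀ {β} → SmallerPairings β → Small β → Pairing (ℕ ⊎ Seg β)
  small⇒pairing IH (inj₁ countable) = pairing-countable countable
  small⇒pairing IH (inj₂ (γ , γ<β , shrink)) = pairing-transfer shrink (<⇒Seg↣Seg γ<β) (IH γ<β)

  ≤-inj₁↣ℕ : ∀ {β} k → Segment (_≤_ {β}) (inj₁ k) ↣ ℕ
  ≤-inj₁↣ℕ {β} k = mk↣ {to = to} injective
    where
    inj₂≰inj₁ : ∀ {s : Seg β} → ¬ (inj₂ s ≤ inj₁ k)
    inj₂≰inj₁ (inj₁ ())
    inj₂≰inj₁ (inj₂ ())
    to : Segment _≤_ (inj₁ k) → ℕ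
    to (inj₁ n , _) = n
    to (inj₂ s , [ s≤k ]) = Irrelevant.⊥-elim (inj₂≰inj₁ s≤k)
    injective : Injective _≡_ _≡_ to
    injective {inj₁ m , _} {inj₁ n , _} refl = refl
    injective {inj₂ s , [ s≤k ]} = Irrelevant.⊥-elim (inj₂≰inj₁ s≤k)
    injective {inj₁ _ , _} {inj₂ s , [ s≤k ]} = Irrelevant.⊥-elim (inj₂≰inj₁ s≤k)

  ≤-inj₂↣ℕ⊎Seg : ∀ {β} γ .(γ<β : γ < β) → Segment (_≤_ {β}) (inj₂ (γ , [ γ<β ])) ↣ (ℕ ⊎ Seg γ)
  ≤-inj₂↣ℕ⊎Seg {β} γ γ<β = retraction⇒↣ {to = to} from from-to
    where
    to : Segment _≤_ (inj₂ (γ , [ γ<β ])) → ℕ ⊎ Seg γ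
    to (inj₁ n , _) = inj₁ (suc n)
    to (inj₂ (x , _) , _) with compare x γ
    ... | tri< x<γ _ _ = inj₂ (x , [ x<γ ])
    ... | tri≈ _ _ _ = inj₁ zero
    ... | tri> _ _ _ = inj₁ zero
    from : ℕ ⊎ Seg γ → Segment _≤_ (inj₂ (γ , [ γ<β ]))
    from (inj₁ zero) = inj₂ (γ , [ γ<β ]) , [ inj₂ refl ]
    from (inj₁ (suc n)) = inj₁ n , [ inj₁ ₁∼₂ ]
    from (inj₂ (x , [ x<γ ])) = inj₂ (x , [ trans x<γ γ<β ]) , [ inj₁ (₂∼₂ x<γ) ]
    from-to : ∀ y → from (to y) ≡ y
    from-to (inj₁ n , _) = refl
    from-to (inj₂ (x , _) , [ x≤γ ]) with compare x γ
    ... | tri< _ _ _ = refl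
    ... | tri≈ _ refl _ = refl
    ... | tri> _ _ γ<x = Irrelevant.⊥-elim (≤⇒≯ x≤γ (₂∼₂ γ<x))

  ≤-segment-small : ∀ {β} (m : ℕ ⊎ Seg β) →
                    (Segment _≤_ m ↣ ℕ) ⊎ ∃[ γ ] γ < β × (Segment _≤_ m ↣ (ℕ ⊎ Seg γ))
  ≤-segment-small (inj₁ k) = inj₁ (≤-inj₁↣ℕ k)
  ≤-segment-small {β} (inj₂ (γ , [ γ<β ])) =
    inj₂ (γ , recompute (tri⇒dec< compare γ β) γ<β , ≤-inj₂↣ℕ⊎Seg γ γ<β)

  square-small : ∀ {β} → SmallerPairings β → (p : (ℕ ⊎ Seg β) × (ℕ ⊎ Seg β)) →
                 (ℕ ⊎ Seg β) ↣ Segment _≺_ p → Small β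
  square-small {β} IH p ↣segment = shrink (≤-segment-small (max p))
    where
    D = Segment _≤_ (max p)
    Seg↣D² : Seg β ↣ (D × D)
    Seg↣D² = Pairs.segment↣square p ↣-∘ (↣segment ↣-∘ mk↣ inj₂-injective)
    shrink : (D ↣ ℕ) ⊎ ∃[ γ ] γ < β × (D ↣ (ℕ ⊎ Seg γ)) → Small β
    shrink (inj₁ D↣ℕ) = inj₁ (ℕ×ℕ↣ℕ ↣-∘ ((D↣ℕ ×-↣ D↣ℕ) ↣-∘ Seg↣D²))
    shrink (inj₂ (γ , γ<β , D↣)) = inj₂ (γ , γ<β , IH γ<β ↣-∘ ((D↣ ×-↣ D↣) ↣-∘ Seg↣D²))

  step : ∀ β → SmallerPairings β → Pairing (ℕ ⊎ Seg β)
  step β IH with em (Small β)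
  ... | inj₁ small = small⇒pairing IH small
  ... | inj₂ ¬small with Comparability.comparable em Pairs.≺-isWellOrder (<ʸ-isWellOrder β)
  ...   | inj₁ pairing = pairing
  ...   | inj₂ (p , ↣segment) = ⊥-elim (¬small (square-small IH p ↣segment))

  segment-pairing : ∀ β → Pairing (ℕ ⊎ Seg β)
  segment-pairing = WF.All.wfRec wellFounded 0ℓ _ step

-- Adjoining a top element makes A itself a segment.
hessenberg : ExcludedMiddle → {A : Set} {_<_ : Rel A 0ℓ} → IsWellOrder _<_ → Pairing (ℕ ⊎ A)
hessenberg em {A} {_<_} wo =
  pairing-transfer (mk↣ inj₂-injective ↣-∘ ↔⇒↣ (↔-sym top-segment)) (↔⇒↣ top-segment)
                   (segment-pairing ⊤⁺)
  where
  open Supremum _<_ using (_<⁺_; [_]<⊤⁺)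
  open Hessenberg em (<⁺-isWellOrder wo) using (Seg; segment-pairing)

  top-segment : Seg ⊤⁺ ↔ A
  top-segment = mk↔ₛ′ lower lift (λ _ → refl) lift-lower
    where
    ⊤⁺≮⊤⁺ : ¬ (⊤⁺ <⁺ ⊤⁺)
    ⊤⁺≮⊤⁺ ()
    lower : Seg ⊤⁺ → A
    lower ([ a ] , _) = a
    lower (⊤⁺ , [ ⊤⁺<⊤⁺ ]) = Irrelevant.⊥-elim (⊤⁺≮⊤⁺ ⊤⁺<⊤⁺)
    lift : A → Seg ⊤⁺
    lift a = [ a ] , [ [ a ]<⊤⁺ ]
    lift-lower : ∀ s → lift (lower s) ≡ s
    lift-lower ([ a ] , _) = refl
    lift-lower (⊤⁺ , [ ⊤⁺<⊤⁺ ]) = Irrelevant.⊥-elim (⊤⁺≮⊤⁺ ⊤⁺<⊤⁺)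

module Construction (G : Graph) where

  data Term : Set where
    old : V G → Term
    new : List Term → List Term → Term

  old-injective : ∀ {u v} → old u ≡ old v → u ≡ v
  old-injective refl = refl

  rank : Term → ℕ
  ranks : List Term → ℕ
  rank (old _) = 0
  rank (new X Y) = suc (ranks X ⊔ ranks Y)
  ranks [] = 0
  ranks (t ∷ ts) = rank t ⊔ ranks ts

  rank≤ranks : ∀ {t ts} → t ∈ ts → rank t ℕ.≤ ranks ts
  rank≤ranks {t} {_ ∷ ts} (here refl) = ℕ.m≤m⊔n (rank t) (ranks ts)
  rank≤ranks {t} {t′ ∷ _} (there t∈ts) = ℕ.≤-trans (rank≤ranks t∈ts) (ℕ.m≤n⊔m (rank t′) _)

  ∈⇒rank<ˡ : ∀ {t X Y} → t ∈ X → rank t ℕ.< rank (new X Y)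
  ∈⇒rank<ˡ {X = X} {Y} t∈X = s≤s (ℕ.≤-trans (rank≤ranks t∈X) (ℕ.m≤m⊔n (ranks X) (ranks Y)))

  ∈⇒rank<ʳ : ∀ {t X Y} → t ∈ Y → rank t ℕ.< rank (new X Y)
  ∈⇒rank<ʳ {X = X} {Y} t∈Y = s≤s (ℕ.≤-trans (rank≤ranks t∈Y) (ℕ.m≤n⊔m (ranks X) (ranks Y)))

  _∈⁺_ : Term → Term → Set
  s ∈⁺ old _ = ⊥
  s ∈⁺ new X _ = s ∈ X

  ∈⁺⇒rank< : ∀ {s t} → s ∈⁺ t → rank s ℕ.< rank t
  ∈⁺⇒rank< {t = new X Y} s∈X = ∈⇒rank<ˡ {Y = Y} s∈X

  OldEdge : Term → Term → Set
  OldEdge (old u) (old v) = E G u v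
  OldEdge _ _ = ⊥

  OldEdge-sym : ∀ {s t} → OldEdge s t → OldEdge t s
  OldEdge-sym {old _} {old _} = Graph.sym G

  Edge : Term → Term → Set
  Edge s t = OldEdge s t ⊎ s ∈⁺ t ⊎ t ∈⁺ s

  Edge-sym : ∀ {s t} → Edge s t → Edge t s
  Edge-sym {s} {t} = ⊎-map (OldEdge-sym {s} {t}) swap

  Edge-old : ∀ {u v} → Edge (old u) (old v) → E G u v
  Edge-old (inj₁ e) = e
  Edge-old (inj₂ (inj₁ ()))
  Edge-old (inj₂ (inj₂ ()))

  Edge-new : ∀ {X Y t} → Edge (new X Y) t → rank (new X Y) ≢ rank t
  Edge-new {X} {Y} {t} (inj₂ (inj₁ s∈⁺t)) = ℕ.<⇒≢ (∈⁺⇒rank< {new X Y} {t} s∈⁺t)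
  Edge-new {X} {Y} {t} (inj₂ (inj₂ t∈⁺s)) = ℕ.<⇒≢ (∈⁺⇒rank< {t} {new X Y} t∈⁺s) ∘ sym

  Edge-irrefl : ∀ {t} → ¬ Edge t t
  Edge-irrefl {old _} e = irrefl G (Edge-old e)
  Edge-irrefl {new _ _} e = Edge-new e refl

  H : Graph
  H = record { V = Term ; E = Edge ; sym = Edge-sym ; irrefl = Edge-irrefl }

  random : IsRandomGraph H
  random X Y disjoint =
    new X Y , ℕ.<-irrefl refl ∘ ∈⇒rank<ˡ {Y = Y} , ℕ.<-irrefl refl ∘ ∈⇒rank<ʳ {X = X} ,
    All.tabulate (inj₂ ∘ inj₂) , All.tabulate non-adjacent
    where
    non-adjacent : ∀ {y} → y ∈ Y → ¬ Edge (new X Y) y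
    non-adjacent y∈Y (inj₂ (inj₁ v∈⁺y)) = ℕ.<-asym (∈⁺⇒rank< v∈⁺y) (∈⇒rank<ʳ {X = X} y∈Y)
    non-adjacent y∈Y (inj₂ (inj₂ y∈X)) = disjoint _ y∈X y∈Y

  embedding : Embedding G H
  embedding = record
    { map = old ; injective = old-injective ; preserves = inj₁ ; reflects = Edge-old }

  old-clique : ∀ {C} → IsClique H C → IsClique G (C ∘ old)
  old-clique clique x y cx cy x≢y = Edge-old (clique (old x) (old y) cx cy (x≢y ∘ old-injective))

  clique-countable : ExcludedMiddle → ∀ {C} → IsSubset C → IsClique H C →
                     Countable (Σ (V G) (C ∘ old)) → Countable (Σ Term C)
  clique-countable em {C} subset clique (f , f-injective) =
    Injection.to C↣ℕ , Injection.injective C↣ℕ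
    where
    code : Σ Term C → ℕ ⊎ ℕ
    code (old v , c) = inj₁ (f (v , c))
    code (new X Y , _) = inj₂ (rank (new X Y))
    same-rank : ∀ {X Y X′ Y′} c c′ → rank (new X Y) ≡ rank (new X′ Y′) →
                _≡_ {A = Σ Term C} (new X Y , c) (new X′ Y′ , c′)
    same-rank {X} {Y} {X′} {Y′} c c′ eq with em (new X Y ≡ new X′ Y′)
    ... | inj₁ refl = cong (new X Y ,_) (subset (new X Y) c c′)
    ... | inj₂ s≢t = ⊥-elim (Edge-new (clique _ _ c c′ s≢t) eq)
    code-injective : ∀ {x y} → code x ≡ code y → x ≡ y
    code-injective {old v , c} {old v′ , c′} eq
      with refl ← f-injective {v , c} {v′ , c′} (inj₁-injective eq) = refl
    code-injective {new X Y , c} {new X′ Y′ , c′} eq = same-rank c c′ (inj₂-injective eq)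
    C↣ℕ : Σ Term C ↣ ℕ
    C↣ℕ = ℕ⊎ℕ↣ℕ ↣-∘ mk↣ code-injective

  no-uncountable-clique : ExcludedMiddle → NoUncountableClique G → NoUncountableClique H
  no-uncountable-clique em no-clique (C , subset , clique , uncountable) =
    uncountable (clique-countable em subset clique old-countable)
    where
    old-countable : Countable (Σ (V G) (C ∘ old))
    old-countable = ¬¬-elim em λ ¬countable →
      no-clique (C ∘ old , subset ∘ old , old-clique clique , ¬countable)

  module _ (pair : Pairing (ℕ ⊎ V G)) where

    private
      ⟪_,_⟫ : ℕ ⊎ V G → ℕ ⊎ V G → ℕ ⊎ V G
      ⟪ x , y ⟫ = Injection.to pair (x , y)

      ⟪⟫-injective : ∀ {x y x′ y′} → ⟪ x , y ⟫ ≡ ⟪ x′ , y′ ⟫ → x ≡ x′ × y ≡ y′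
      ⟪⟫-injective = ≡⇒≡×≡ ∘ Injection.injective pair

      tag₀ tag₁ : ℕ ⊎ V G
      tag₀ = inj₁ 0
      tag₁ = inj₁ 1

      encode : Term → ℕ ⊎ V G
      encodes : List Term → ℕ ⊎ V G
      encode (old a) = ⟪ tag₀ , inj₂ a ⟫
      encode (new X Y) = ⟪ tag₁ , ⟪ encodes X , encodes Y ⟫ ⟫
      encodes [] = ⟪ tag₀ , tag₀ ⟫
      encodes (t ∷ ts) = ⟪ tag₁ , ⟪ encode t , encodes ts ⟫ ⟫

      encode-injective : ∀ s t → encode s ≡ encode t → s ≡ t
      encodes-injective : ∀ ss ts → encodes ss ≡ encodes ts → ss ≡ ts
      encode-injective (old a) (old b) eq = cong old (inj₂-injective (proj₂ (⟪⟫-injective eq)))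
      encode-injective (old _) (new _ _) eq with () ← proj₁ (⟪⟫-injective eq)
      encode-injective (new _ _) (old _) eq with () ← proj₁ (⟪⟫-injective eq)
      encode-injective (new X Y) (new X′ Y′) eq
        with (X≡X′ , Y≡Y′) ← ⟪⟫-injective (proj₂ (⟪⟫-injective eq)) =
        cong₂ new (encodes-injective X X′ X≡X′) (encodes-injective Y Y′ Y≡Y′)
      encodes-injective [] [] eq = refl
      encodes-injective [] (_ ∷ _) eq with () ← proj₁ (⟪⟫-injective eq)
      encodes-injective (_ ∷ _) [] eq with () ← proj₁ (⟪⟫-injective eq)
      encodes-injective (s ∷ ss) (t ∷ ts) eq
        with (s≡t , ss≡ts) ← ⟪⟫-injective (proj₂ (⟪⟫-injective eq)) =
        cong₂ _∷_ (encode-injective s t s≡t) (encodes-injective ss ts ss≡ts)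

    Term↣ℕ⊎V : Term ↣ (ℕ ⊎ V G)
    Term↣ℕ⊎V = mk↣ (encode-injective _ _)

proposition3p3 : ExcludedMiddle →
    (G : Graph) → WellOrderable (V G) → Infinite (V G) → NoUncountableClique G →
    Σ[ H ∈ Graph ] (SameCardinality (V H) (V G) × IsRandomGraph H × NoUncountableClique H × Embedding G H)
proposition3p3 em G (_<_ , sto , wf) (ι , ι-injective) no-clique =
  H , cantor-schröder-bernstein em Term↣V (mk↣ old-injective) , random ,
  no-uncountable-clique em no-clique , embedding
  where
  open Construction G
  open IsStrictTotalOrder sto using (compare; trans)
  wo : IsWellOrder _<_
  wo = record { compare = compare ; trans = trans ; wellFounded = wf }
  Term↣V : Term ↣ V G
  Term↣V = hilbert-hotel em (mk↣ ι-injective) ↣-∘ Term↣ℕ⊎V (hessenberg em wo)
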